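{- Every graph obtained by the following procedure is a connected unicyclic graph that is not König–Egerváry. Procedure: (1) Construct an odd cycle and color its vertices blue. (2) Either perform step (3), or perform step (4), or stop. (3) Choose any existing vertex $u$, add two new vertices $u_1,u_2$ and edges $uu_1, u_1u_2$; color $u_1$ red and $u_2$ black; go to (2). (4) If there is no red vertex go to (2); otherwise choose a red vertex $u$, add a new vertex $u_1$ and the edge $uu_1$, color $u_1$ black; go to (2).
   Context: All graphs are finite and simple. $\alpha(G)$ is the maximum size of an independent set and $\mu(G)$ the maximum size of a matching. $G$ is König–Egerváry if $\alpha(G)+\mu(G)=|V(G)|$. A graph is unicyclic if it contains exactly one cycle. -}

module Defs where

open import Data.Nat using (ℕ; zero; suc; _+_; _≤_; _≡ᵇ_; _%_)
open import Data.Bool using (Bool; true; false; _∨_; _∧_)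
open import Data.Fin using (Fin; zero; suc; toℕ; _≟_)
open import Data.Fin.Subset using (Subset; _∈_; ∣_∣)
open import Data.List using (List; []; _∷_; _++_; take; length; concatMap)
open import Data.List.Relation.Unary.All using (All)
open import Data.List.Relation.Unary.Unique.Propositional using (Unique)
open import Data.Product using (Σ; _×_; _,_)
open import Data.Sum using (_⊎_)
open import Relation.Binary.PropositionalEquality using (_≡_)
open import Relation.Nullary.Decidable using (⌊_⌋)

-- A (simple) graph on the vertex set Fin n, given by a Bool-valued adjacency
-- function.  All graphs produced below are symmetric and loopless by construction.
Graph : ℕ → Set
Graph n = Fin n → Fin n → Bool

Adj : ∀ {n} → Graph n → Fin n → Fin n → Set
Adj G a b = G a b ≡ true

data Color : Set where
  blue red black : Color

cycleGraph : (k : ℕ) → Graph k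
cycleGraph k i j =
  (suc (toℕ i) ≡ᵇ toℕ j) ∨ (suc (toℕ j) ≡ᵇ toℕ i)
  ∨ ((toℕ i ≡ᵇ 0) ∧ (suc (toℕ j) ≡ᵇ k))
  ∨ ((toℕ j ≡ᵇ 0) ∧ (suc (toℕ i) ≡ᵇ k))

-- Add a new vertex (index zero; old vertex i becomes suc i) joined to u only.
addLeaf : ∀ {n} → Graph n → Fin n → Graph (suc n)
addLeaf G u zero    zero    = false
addLeaf G u zero    (suc j) = ⌊ j ≟ u ⌋
addLeaf G u (suc i) zero    = ⌊ i ≟ u ⌋
addLeaf G u (suc i) (suc j) = G i j

extend : ∀ {n} → Color → (Fin n → Color) → Fin (suc n) → Color
extend col c zero    = col
extend col c (suc i) = c i

data Built : (n : ℕ) → Graph n → (Fin n → Color) → Set where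
  step1 : (k : ℕ) → k % 2 ≡ 1 → 3 ≤ k → Built k (cycleGraph k) (λ _ → blue)
  -- step (3): new u1 (red) adjacent to u, new u2 (black) adjacent to u1
  step3 : ∀ {n G c} → Built n G c → (u : Fin n) →
          Built (suc (suc n)) (addLeaf (addLeaf G u) zero) (extend black (extend red c))
  step4 : ∀ {n G c} → Built n G c → (u : Fin n) → c u ≡ red →
          Built (suc n) (addLeaf G u) (extend black c)

data Walk {n} (G : Graph n) : Fin n → Fin n → Set where
  [] : ∀ {a} → Walk G a a
  _∷_ : ∀ {a b c} → Adj G a b → Walk G b c → Walk G a c

Connected : ∀ {n} → Graph n → Set
Connected {n} G = (a b : Fin n) → Walk G a b

data Consec {A : Set} : List A → A → A → Set where
  here  : ∀ {a b xs} → Consec (a ∷ b ∷ xs) a b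
  there : ∀ {x xs a b} → Consec xs a b → Consec (x ∷ xs) a b

-- {a,b} is an edge of the closed cycle v0 v1 … v(k-1) v0.
CycEdge : ∀ {n} → List (Fin n) → Fin n → Fin n → Set
CycEdge vs a b = Consec (vs ++ take 1 vs) a b ⊎ Consec (vs ++ take 1 vs) b a

IsCycle : ∀ {n} → Graph n → List (Fin n) → Set
IsCycle G vs = (3 ≤ length vs) × Unique vs × (∀ a b → CycEdge vs a b → Adj G a b)

-- Two vertex lists describe the same cycle (subgraph) iff they have the same edge set.
SameCycle : ∀ {n} → List (Fin n) → List (Fin n) → Set
SameCycle vs ws = ∀ a b → (CycEdge vs a b → CycEdge ws a b) × (CycEdge ws a b → CycEdge vs a b)

Unicyclic : ∀ {n} → Graph n → Set
Unicyclic G = Σ (List _) λ vs → IsCycle G vs × (∀ ws → IsCycle G ws → SameCycle vs ws)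

Independent : ∀ {n} → Graph n → Subset n → Set
Independent {n} G S = (a b : Fin n) → a ∈ S → b ∈ S → G a b ≡ false

IsAlpha : ∀ {n} → Graph n → ℕ → Set
IsAlpha G k = (Σ _ λ S → Independent G S × ∣ S ∣ ≡ k)
            × (∀ S → Independent G S → ∣ S ∣ ≤ k)

endpoints : ∀ {n} → List (Fin n × Fin n) → List (Fin n)
endpoints = concatMap (λ { (a , b) → a ∷ b ∷ [] })

Matching : ∀ {n} → Graph n → List (Fin n × Fin n) → Set
Matching G M = All (λ { (a , b) → Adj G a b }) M × Unique (endpoints M)

IsMu : ∀ {n} → Graph n → ℕ → Set
IsMu G k = (Σ _ λ M → Matching G M × length M ≡ k)
         × (∀ M → Matching G M → length M ≤ k)

KonigEgervary : ∀ {n} → Graph n → Set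
KonigEgervary {n} G = Σ ℕ λ a → Σ ℕ λ m → IsAlpha G a × IsMu G m × a + m ≡ n

-- Each graph built by the procedure satisfies α(G) ≤ a and μ(G) ≤ b for some a, b with a + b + 1 = |V(G)|,
-- so α(G) + μ(G) < |V(G)|. The odd cycle C(2t+1) starts with a = b = t, and step (3) raises a and b by one.
-- Step (4) raises only a: the new leaf can only be matched to the red vertex u. To make this induction go through,
-- the bound on matchings is strengthened to |M| + #(red vertices not covered by M) ≤ b; a matching that uses
-- the new edge loses u from that count. Adding a vertex of degree one preserves connectivity and creates no cycle.
module Submission where

open import Defs
open import Data.Bool using (T; _∧_; if_then_else_)
open import Data.Bool.Properties using (T-≡; T-∨; T-∧)
open import Data.Empty using (⊥; ⊥-elim)
open import Data.Fin using (Fin; zero; suc; toℕ; fromℕ; fromℕ<)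
open import Data.Fin.Properties
  using (_≟_; suc-injective; toℕ-injective; toℕ<n; toℕ-fromℕ; toℕ-fromℕ<; injective⇒≤)
open import Data.Fin.Subset using (Subset; Side; inside; outside; ∣_∣; _⊆_; _⊂_)
  renaming (⊥ to ⊥ₛ; _∈_ to _∈ₛ_; _∉_ to _∉ₛ_)
open import Data.Fin.Subset.Properties using (p⊆q⇒∣p∣≤∣q∣; p⊂q⇒∣p∣<∣q∣; ∣⊥∣≡0)
open import Data.List using (List; []; _∷_; _++_; take; length; map; lookup; tabulate; allFin)
open import Data.List.Properties using (map-++; length-map; length-tabulate)
open import Data.List.Membership.Propositional using (_∈_; _∉_)
open import Data.List.Membership.Propositional.Properties using (∈-lookup; ∈-++⁺ˡ; ∈-++⁻)
open import Data.List.Relation.Unary.All as All using (All; []; _∷_)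
open import Data.List.Relation.Unary.All.Properties using (¬Any⇒All¬)
open import Data.List.Relation.Unary.AllPairs using ([]; _∷_)
open import Data.List.Relation.Unary.Any using (here; there; any?)
open import Data.List.Relation.Unary.Unique.Propositional using (Unique)
import Data.List.Relation.Unary.Unique.Propositional.Properties as Unique
open import Data.Nat using (ℕ; zero; suc; _+_; _*_; _%_; _/_; _≡ᵇ_; _≤_; _<_; z≤n; s≤s)
open import Data.Nat.DivMod using (m≡m%n+[m/n]*n)
open import Data.Nat.Properties
  using (≡ᵇ⇒≡; ≡⇒≡ᵇ; ≤-refl; ≤-reflexive; ≤-trans; ≤-pred; <-irrefl; 1+n≰n; n≤1+n; n≤0⇒n≡0; m≤m+n;
         +-comm; +-suc; +-identityʳ; +-mono-≤; +-monoʳ-≤; *-comm; module ≤-Reasoning)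
import Data.Nat.Properties as ℕ
open import Data.Product using (Σ; ∃₂; _×_; _,_; proj₁; proj₂)
open import Data.Product.Function.NonDependent.Propositional using (_×-⇔_)
open import Data.Sum as Sum using (_⊎_; inj₁; inj₂)
open import Data.Sum.Function.Propositional using (_⊎-⇔_)
open import Data.Vec.Base as Vec using ([]; _∷_)
open import Data.Vec.Properties using (lookup∘tabulate; lookup⇒[]=; []=⇒lookup)
open import Function using (_∘_; id)
open import Function.Bundles using (Equivalence; _⇔_; mk⇔)
open import Function.Construct.Composition using (_⇔-∘_)
open import Function.Construct.Symmetry using (⇔-sym)
open import Level using (0ℓ)
open import Relation.Binary.PropositionalEquality
  using (_≡_; _≢_; refl; sym; trans; cong; cong₂; subst; subst₂; module ≡-Reasoning)
open import Relation.Nullary.Decidable using (Dec; yes; no; does; ¬?; _×-dec_; toWitness; fromWitness)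
open import Relation.Nullary.Negation using (¬_; contradiction)
open import Relation.Unary using (Pred; Decidable)

-- Lists read as cycles

module _ {A : Set} where

  consec-∈ˡ : ∀ {xs : List A} {a b} → Consec xs a b → a ∈ xs
  consec-∈ˡ here      = here refl
  consec-∈ˡ (there c) = there (consec-∈ˡ c)

  consec-∈ʳ : ∀ {xs : List A} {a b} → Consec xs a b → b ∈ xs
  consec-∈ʳ here      = there (here refl)
  consec-∈ʳ (there c) = there (consec-∈ʳ c)

  consec-pred≢succ : ∀ {xs : List A} {p x q} → Unique xs → Consec xs p x → Consec xs x q → p ≢ q
  consec-pred≢succ ((a≢a ∷ _) ∷ _) here      here      = ⊥-elim (a≢a refl)
  consec-pred≢succ (a∉ ∷ _)         here      (there c) = All.lookup a∉ (consec-∈ʳ c)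
  consec-pred≢succ (a∉ ∷ _)         (there c) here      = ⊥-elim (All.lookup a∉ (consec-∈ʳ c) refl)
  consec-pred≢succ (_ ∷ u)          (there c) (there d) = consec-pred≢succ u c d

  consec-last : ∀ (a : A) xs e → Σ A λ z → z ∈ a ∷ xs × Consec (a ∷ xs ++ e ∷ []) z e
  consec-last a []       e = a , here refl , here
  consec-last a (b ∷ xs) e with consec-last b xs e
  ... | z , z∈ , c = z , there z∈ , there c

  consec-succ : ∀ {x : A} {xs} e → x ∈ xs → Σ A λ q → Consec (xs ++ e ∷ []) x q
  consec-succ {xs = _ ∷ []}    e (here refl) = e , here
  consec-succ {xs = _ ∷ y ∷ _} e (here refl) = y , here
  consec-succ {xs = _ ∷ _}     e (there x∈) with consec-succ e x∈
  ... | q , c = q , there c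

  consec-pred : ∀ {x : A} {xs} e → x ∈ xs → Σ A λ p → Consec (e ∷ xs) p x
  consec-pred e (here refl) = e , here
  consec-pred {xs = a ∷ _} e (there x∈) with consec-pred a x∈
  ... | p , c = p , there c

module _ {n : ℕ} where

  cycle-neighbours : ∀ (ws : List (Fin n)) {x} → 3 ≤ length ws → Unique ws → x ∈ ws →
                     ∃₂ λ y z → y ≢ z × CycEdge ws x y × CycEdge ws x z
  cycle-neighbours (_ ∷ [])     (s≤s ()) _ _
  cycle-neighbours (_ ∷ _ ∷ []) (s≤s (s≤s ())) _ _
  cycle-neighbours (e ∷ x₁ ∷ x₂ ∷ r) _ (_ ∷ x₁∉ ∷ _) (here refl) with consec-last x₂ r e
  ... | z , z∈ , c = x₁ , z , All.lookup x₁∉ z∈ , inj₁ here , inj₂ (there (there c))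
  cycle-neighbours (e ∷ x₁ ∷ x₂ ∷ r) {x} _ (e∉ ∷ u) (there x∈)
    with consec-succ e x∈ | consec-pred e (∈-++⁺ˡ x∈)
  ... | q , cq | p , cp = q , p , succ≢pred cp cq , inj₁ (there cq) , inj₂ cp
    where
    rest : List (Fin n)
    rest = x₁ ∷ x₂ ∷ r ++ e ∷ []
    unique-rest : Unique rest
    unique-rest = Unique.++⁺ u ([] ∷ []) λ { (e∈ , here refl) → All.lookup e∉ e∈ refl }
    succ≢pred : ∀ {p q} → Consec (e ∷ rest) p x → Consec rest x q → q ≢ p
    succ≢pred here      here      q≡p = All.lookup e∉ (there (here refl)) (sym q≡p)
    succ≢pred here      (there c) _   with unique-rest
    ... | x₁∉ ∷ _ = All.lookup x₁∉ (consec-∈ˡ c) refl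
    succ≢pred (there c) d         q≡p = consec-pred≢succ unique-rest c d (sym q≡p)

unique-length≤ : ∀ {n} (xs : List (Fin n)) → Unique xs → length xs ≤ n
unique-length≤ xs u = injective⇒≤ (unique-lookup-injective xs u)
  where
  unique-lookup-injective : ∀ xs → Unique xs → ∀ {i j} → lookup xs i ≡ lookup xs j → i ≡ j
  unique-lookup-injective (x ∷ xs) (x∉ ∷ u) {zero}  {zero}  _  = refl
  unique-lookup-injective (x ∷ xs) (x∉ ∷ u) {zero}  {suc j} eq = ⊥-elim (All.lookup x∉ (∈-lookup j) eq)
  unique-lookup-injective (x ∷ xs) (x∉ ∷ u) {suc i} {zero}  eq = ⊥-elim (All.lookup x∉ (∈-lookup i) (sym eq))
  unique-lookup-injective (x ∷ xs) (x∉ ∷ u) {suc i} {suc j} eq = cong suc (unique-lookup-injective xs u eq)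

module _ {A B : Set} (f : A → B) where

  consec-map⁺ : ∀ {xs a b} → Consec xs a b → Consec (map f xs) (f a) (f b)
  consec-map⁺ here      = here
  consec-map⁺ (there c) = there (consec-map⁺ c)

  consec-map⁻ : ∀ xs {a′ b′} → Consec (map f xs) a′ b′ → ∃₂ λ a b → Consec xs a b × f a ≡ a′ × f b ≡ b′
  consec-map⁻ (x ∷ y ∷ xs) here      = x , y , here , refl , refl
  consec-map⁻ (x ∷ xs)     (there c) with consec-map⁻ xs c
  ... | a , b , c′ , refl , refl = a , b , there c′ , refl , refl

  map-closed : ∀ xs → map f xs ++ take 1 (map f xs) ≡ map f (xs ++ take 1 xs)
  map-closed []       = refl
  map-closed (x ∷ xs) = cong (f x ∷_) (sym (map-++ f xs (x ∷ [])))

module _ {m n : ℕ} (f : Fin m → Fin n) where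

  cycEdge-map⁺ : ∀ ws {a b} → CycEdge ws a b → CycEdge (map f ws) (f a) (f b)
  cycEdge-map⁺ ws (inj₁ c) = inj₁ (subst (λ zs → Consec zs _ _) (sym (map-closed f ws)) (consec-map⁺ f c))
  cycEdge-map⁺ ws (inj₂ c) = inj₂ (subst (λ zs → Consec zs _ _) (sym (map-closed f ws)) (consec-map⁺ f c))

  cycEdge-map⁻ : ∀ ws {a′ b′} → CycEdge (map f ws) a′ b′ →
                 ∃₂ λ a b → CycEdge ws a b × f a ≡ a′ × f b ≡ b′
  cycEdge-map⁻ ws (inj₁ c) with consec-map⁻ f (ws ++ take 1 ws) (subst (λ zs → Consec zs _ _) (map-closed f ws) c)
  ... | a , b , c′ , fa , fb = a , b , inj₁ c′ , fa , fb
  cycEdge-map⁻ ws (inj₂ c) with consec-map⁻ f (ws ++ take 1 ws) (subst (λ zs → Consec zs _ _) (map-closed f ws) c)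
  ... | a , b , c′ , fb , fa = b , a , inj₂ c′ , fa , fb

closed-∈ : ∀ {A : Set} (ws : List A) {w} → w ∈ ws ++ take 1 ws → w ∈ ws
closed-∈ (x ∷ ws) w∈ with ∈-++⁻ (x ∷ ws) w∈
... | inj₁ w∈ws        = w∈ws
... | inj₂ (here refl) = here refl

cycEdge-∈ʳ : ∀ {n} {ws : List (Fin n)} {x y} → CycEdge ws x y → y ∈ ws
cycEdge-∈ʳ {ws = ws} (inj₁ c) = closed-∈ ws (consec-∈ʳ c)
cycEdge-∈ʳ {ws = ws} (inj₂ c) = closed-∈ ws (consec-∈ˡ c)

range : ℕ → ℕ → List ℕ
range s zero    = []
range s (suc m) = s ∷ range (suc s) m

map-toℕ-tabulate : ∀ {n k} (f : Fin n → Fin k) s → (∀ i → toℕ (f i) ≡ s + toℕ i) →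
                   map toℕ (tabulate f) ≡ range s n
map-toℕ-tabulate {zero}  f s f≗ = refl
map-toℕ-tabulate {suc n} f s f≗ =
  cong₂ _∷_ (trans (f≗ zero) (+-identityʳ s))
            (map-toℕ-tabulate (f ∘ suc) (suc s) λ i → trans (f≗ (suc i)) (+-suc s (toℕ i)))

consec-range : ∀ s m e {x y} → Consec (range s m ++ e ∷ []) x y → suc x ≡ y ⊎ (suc x ≡ s + m × y ≡ e)
consec-range s zero          e (there ())
consec-range s (suc zero)    e (there (there ()))
consec-range s (suc zero)    e here      = inj₂ (sym (trans (+-suc s 0) (cong suc (+-identityʳ s))) , refl)
consec-range s (suc (suc m)) e here      = inj₁ refl
consec-range s (suc (suc m)) e (there c) with consec-range (suc s) (suc m) e c
... | inj₁ p       = inj₁ p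
... | inj₂ (p , q) = inj₂ (trans p (sym (+-suc s (suc m))) , q)

avoiding-zero⇒map-suc : ∀ {n} (ws : List (Fin (suc n))) → zero ∉ ws → Σ (List (Fin n)) λ vs → ws ≡ map suc vs
avoiding-zero⇒map-suc []           _  = [] , refl
avoiding-zero⇒map-suc (zero  ∷ ws) 0∉ = ⊥-elim (0∉ (here refl))
avoiding-zero⇒map-suc (suc v ∷ ws) 0∉ with avoiding-zero⇒map-suc ws (0∉ ∘ there)
... | vs , refl = v ∷ vs , refl

-- Attaching a pendant vertex

module _ {n} {G : Graph n} where

  _++ʷ_ : ∀ {a b c} → Walk G a b → Walk G b c → Walk G a c
  []      ++ʷ w′ = w′
  (e ∷ w) ++ʷ w′ = e ∷ (w ++ʷ w′)

  reverseʷ : (∀ a b → Adj G a b → Adj G b a) → ∀ {a b} → Walk G a b → Walk G b a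
  reverseʷ adj-sym []      = []
  reverseʷ adj-sym (e ∷ w) = reverseʷ adj-sym w ++ʷ (adj-sym _ _ e ∷ [])

module _ {n : ℕ} (G : Graph n) (u : Fin n) where

  leaf-adj⁻ : ∀ {y} → Adj (addLeaf G u) zero y → y ≡ suc u
  leaf-adj⁻ {suc j} e = cong suc (toWitness (Equivalence.from T-≡ e))

  leaf-adj : Adj (addLeaf G u) zero (suc u)
  leaf-adj = Equivalence.to T-≡ (fromWitness refl)

  addLeaf-walk : ∀ {a b} → Walk G a b → Walk (addLeaf G u) (suc a) (suc b)
  addLeaf-walk []      = []
  addLeaf-walk (e ∷ w) = e ∷ addLeaf-walk w

  addLeaf-connected : Connected G → Connected (addLeaf G u)
  addLeaf-connected conn zero    zero    = []
  addLeaf-connected conn zero    (suc b) = leaf-adj ∷ addLeaf-walk (conn u b)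
  addLeaf-connected conn (suc a) zero    = addLeaf-walk (conn a u) ++ʷ (leaf-adj ∷ [])
  addLeaf-connected conn (suc a) (suc b) = addLeaf-walk (conn a b)

  leaf∉cycle : ∀ {ws} → IsCycle (addLeaf G u) ws → zero ∉ ws
  leaf∉cycle {ws} (3≤ , uniq , edges) 0∈ with cycle-neighbours ws 3≤ uniq 0∈
  ... | y , z , y≢z , 0y , 0z = y≢z (trans (leaf-adj⁻ (edges zero y 0y)) (sym (leaf-adj⁻ (edges zero z 0z))))

  addLeaf-cycle : ∀ {vs} → IsCycle G vs → IsCycle (addLeaf G u) (map suc vs)
  addLeaf-cycle {vs} (3≤ , uniq , edges) =
    subst (3 ≤_) (sym (length-map suc vs)) 3≤ , Unique.map⁺ suc-injective uniq , edges′
    where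
    edges′ : ∀ a b → CycEdge (map suc vs) a b → Adj (addLeaf G u) a b
    edges′ _ _ e with cycEdge-map⁻ suc vs e
    ... | a , b , e′ , refl , refl = edges a b e′

  addLeaf-cycle⁻ : ∀ {vs} → IsCycle (addLeaf G u) (map suc vs) → IsCycle G vs
  addLeaf-cycle⁻ {vs} (3≤ , uniq , edges) =
    subst (3 ≤_) (length-map suc vs) 3≤ , Unique.map⁻ uniq , λ a b e → edges (suc a) (suc b) (cycEdge-map⁺ suc vs e)

  sameCycle-map-suc : ∀ {vs ws : List (Fin n)} → SameCycle vs ws → SameCycle (map suc vs) (map suc ws)
  sameCycle-map-suc {vs} {ws} same a b = transport vs ws (λ x y → proj₁ (same x y)) , transport ws vs (λ x y → proj₂ (same x y))
    where
    transport : ∀ xs ys → (∀ x y → CycEdge xs x y → CycEdge ys x y) → CycEdge (map suc xs) a b → CycEdge (map suc ys) a b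
    transport xs ys h e with cycEdge-map⁻ suc xs e
    ... | a′ , b′ , e′ , refl , refl = cycEdge-map⁺ suc ys (h a′ b′ e′)

  addLeaf-unicyclic : Unicyclic G → Unicyclic (addLeaf G u)
  addLeaf-unicyclic (vs , cyc , unique) = map suc vs , addLeaf-cycle cyc , same
    where
    same : ∀ ws → IsCycle (addLeaf G u) ws → SameCycle (map suc vs) ws
    same ws cyc′ with avoiding-zero⇒map-suc ws (leaf∉cycle cyc′)
    ... | ws₀ , refl = sameCycle-map-suc {vs} {ws₀} (unique ws₀ (addLeaf-cycle⁻ cyc′))

α≤ : ∀ {n} → Graph n → ℕ → Set
α≤ {n} G a = (S : Subset n) → Independent G S → ∣ S ∣ ≤ a

∣p∣≤1+∣tail-p∣ : ∀ {n} (p : Subset (suc n)) → ∣ p ∣ ≤ suc ∣ Vec.tail p ∣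
∣p∣≤1+∣tail-p∣ (inside  ∷ p) = ≤-refl
∣p∣≤1+∣tail-p∣ (outside ∷ p) = n≤1+n ∣ p ∣

independent-addLeaf⁻ : ∀ {n} (G : Graph n) u {x S} → Independent (addLeaf G u) (x ∷ S) → Independent G S
independent-addLeaf⁻ G u ind a b a∈ b∈ = ind (suc a) (suc b) (Vec.there a∈) (Vec.there b∈)

module _ {n : ℕ} (G : Graph n) (u : Fin n) where

  private
    independent-addPendantEdge⁻ : ∀ {x y S} → Independent (addLeaf (addLeaf G u) zero) (x ∷ y ∷ S) → Independent G S
    independent-addPendantEdge⁻ = independent-addLeaf⁻ G u ∘ independent-addLeaf⁻ (addLeaf G u) zero

  α≤-addLeaf : ∀ {a} → α≤ G a → α≤ (addLeaf G u) (suc a)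
  α≤-addLeaf α≤a (x ∷ S) ind = ≤-trans (∣p∣≤1+∣tail-p∣ (x ∷ S)) (s≤s (α≤a S (independent-addLeaf⁻ G u ind)))

  -- Of the two new adjacent vertices at most one is in an independent set.
  α≤-addPendantEdge : ∀ {a} → α≤ G a → α≤ (addLeaf (addLeaf G u) zero) (suc a)
  α≤-addPendantEdge α≤a (inside ∷ inside ∷ S) ind with ind zero (suc zero) Vec.here (Vec.there Vec.here)
  ... | ()
  α≤-addPendantEdge α≤a (inside ∷ outside ∷ S) ind = s≤s (α≤a S (independent-addPendantEdge⁻ ind))
  α≤-addPendantEdge α≤a (outside ∷ y ∷ S) ind =
    ≤-trans (∣p∣≤1+∣tail-p∣ (y ∷ S)) (s≤s (α≤a S (independent-addPendantEdge⁻ ind)))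

-- Matchings and uncovered red vertices

subset-of : ∀ {n} {P : Pred (Fin n) 0ℓ} → Decidable P → Subset n
subset-of P? = Vec.tabulate λ v → if does (P? v) then inside else outside

module _ {n} {P : Pred (Fin n) 0ℓ} (P? : Decidable P) where

  private
    side : ∀ {v} → Dec (P v) → Side
    side d = if does d then inside else outside

    side≡inside⁺ : ∀ {v} (d : Dec (P v)) → P v → side d ≡ inside
    side≡inside⁺ (yes _)  _  = refl
    side≡inside⁺ (no ¬pv) pv = ⊥-elim (¬pv pv)

    side≡inside⁻ : ∀ {v} (d : Dec (P v)) → side d ≡ inside → P v
    side≡inside⁻ (yes pv) _ = pv

  ∈-subset-of⁺ : ∀ {v} → P v → v ∈ₛ subset-of P?
  ∈-subset-of⁺ {v} pv = lookup⇒[]= v _ (trans (lookup∘tabulate _ v) (side≡inside⁺ (P? v) pv))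

  ∈-subset-of⁻ : ∀ {v} → v ∈ₛ subset-of P? → P v
  ∈-subset-of⁻ {v} v∈ = side≡inside⁻ (P? v) (trans (sym (lookup∘tabulate _ v)) ([]=⇒lookup v∈))

∣p∣≡∣tail-p∣ : ∀ {n} (p : Subset (suc n)) → zero ∉ₛ p → ∣ p ∣ ≡ ∣ Vec.tail p ∣
∣p∣≡∣tail-p∣ (outside ∷ p) _  = refl
∣p∣≡∣tail-p∣ (inside  ∷ p) 0∉ = ⊥-elim (0∉ Vec.here)

isRed? : (x : Color) → Dec (x ≡ red)
isRed? blue  = no λ ()
isRed? red   = yes refl
isRed? black = no λ ()

uncoveredRed? : ∀ {n} (c : Fin n → Color) M → Decidable λ v → c v ≡ red × v ∉ endpoints M
uncoveredRed? c M v = isRed? (c v) ×-dec ¬? (any? (v ≟_) (endpoints M))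

uncoveredReds : ∀ {n} → (Fin n → Color) → List (Fin n × Fin n) → Subset n
uncoveredReds c M = subset-of (uncoveredRed? c M)

Potential≤ : ∀ {n} → Graph n → (Fin n → Color) → ℕ → Set
Potential≤ G c b = ∀ M → Matching G M → length M + ∣ uncoveredReds c M ∣ ≤ b

restrict : ∀ {n} → List (Fin (suc n) × Fin (suc n)) → List (Fin n × Fin n)
restrict []                    = []
restrict ((zero  , _)     ∷ M) = restrict M
restrict ((suc a , zero)  ∷ M) = restrict M
restrict ((suc a , suc b) ∷ M) = (a , b) ∷ restrict M

restrict-endpoints : ∀ {n} M {v : Fin n} → v ∈ endpoints (restrict M) → suc v ∈ endpoints M
restrict-endpoints ((zero  , _)     ∷ M) v∈                  = there (there (restrict-endpoints M v∈))
restrict-endpoints ((suc a , zero)  ∷ M) v∈                  = there (there (restrict-endpoints M v∈))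
restrict-endpoints ((suc a , suc b) ∷ M) (here refl)         = here refl
restrict-endpoints ((suc a , suc b) ∷ M) (there (here refl)) = there (here refl)
restrict-endpoints ((suc a , suc b) ∷ M) (there (there v∈))  = there (there (restrict-endpoints M v∈))

module _ {n : ℕ} (G : Graph n) (u : Fin n) where

  restrict-matching : ∀ M → Matching (addLeaf G u) M → Matching G (restrict M)
  restrict-matching []                    _ = [] , []
  restrict-matching ((zero  , zero)  ∷ M) (() ∷ _ , _)
  restrict-matching ((zero  , suc _) ∷ M) (_ ∷ adj , _ ∷ _ ∷ uniq) = restrict-matching M (adj , uniq)
  restrict-matching ((suc _ , zero)  ∷ M) (_ ∷ adj , _ ∷ _ ∷ uniq) = restrict-matching M (adj , uniq)
  restrict-matching ((suc a , suc b) ∷ M) (ab ∷ adj , (a≢b ∷ a∉) ∷ b∉ ∷ uniq)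
    with restrict-matching M (adj , uniq)
  ... | adj′ , uniq′ = ab ∷ adj′ , (a≢b ∘ cong suc ∷ avoid a∉) ∷ avoid b∉ ∷ uniq′
    where
    avoid : ∀ {x} → All (suc x ≢_) (endpoints M) → All (x ≢_) (endpoints (restrict M))
    avoid x∉ = ¬Any⇒All¬ _ λ x∈ → All.lookup x∉ (restrict-endpoints M x∈) refl

  data LeafCover (M : List (Fin (suc n) × Fin (suc n))) : Set where
    leaf-unmatched : length M ≡ length (restrict M) → LeafCover M
    leaf-matched   : zero ∈ endpoints M → suc u ∈ endpoints M → u ∉ endpoints (restrict M) →
                     length M ≡ suc (length (restrict M)) → LeafCover M

  leaf-cover : ∀ M → Matching (addLeaf G u) M → LeafCover M
  leaf-cover []                    _ = leaf-unmatched refl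
  leaf-cover ((zero  , zero)  ∷ M) (() ∷ _ , _)
  leaf-cover ((zero  , suc b) ∷ M) (ab ∷ adj , _ ∷ b∉ ∷ uniq) with leaf-adj⁻ G u {suc _} ab | leaf-cover M (adj , uniq)
  ... | refl | leaf-unmatched len =
    leaf-matched (here refl) (there (here refl)) (λ u∈ → All.lookup b∉ (restrict-endpoints M u∈) refl) (cong suc len)
  ... | refl | leaf-matched _ su∈ _ _ = ⊥-elim (All.lookup b∉ su∈ refl)
  leaf-cover ((suc a , zero)  ∷ M) (ab ∷ adj , (_ ∷ a∉) ∷ _ ∷ uniq) with leaf-adj⁻ G u {suc _} ab | leaf-cover M (adj , uniq)
  ... | refl | leaf-unmatched len =
    leaf-matched (there (here refl)) (here refl) (λ u∈ → All.lookup a∉ (restrict-endpoints M u∈) refl) (cong suc len)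
  ... | refl | leaf-matched _ su∈ _ _ = ⊥-elim (All.lookup a∉ su∈ refl)
  leaf-cover ((suc a , suc b) ∷ M) (_ ∷ adj , (_ ∷ a∉) ∷ b∉ ∷ uniq) with leaf-cover M (adj , uniq)
  ... | leaf-unmatched len = leaf-unmatched (cong suc len)
  ... | leaf-matched 0∈ su∈ u∉ len = leaf-matched (there (there 0∈)) (there (there su∈)) u∉′ (cong suc len)
    where
    u∉′ : u ∉ endpoints ((a , b) ∷ restrict M)
    u∉′ (here refl)         = All.lookup a∉ su∈ refl
    u∉′ (there (here refl)) = All.lookup b∉ su∈ refl
    u∉′ (there (there u∈))  = u∉ u∈

tail-uncoveredReds⊆ : ∀ {n} (c : Fin n → Color) col M → Vec.tail (uncoveredReds (extend col c) M) ⊆ uncoveredReds c (restrict M)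
tail-uncoveredReds⊆ c col M v∈ with ∈-subset-of⁻ (uncoveredRed? (extend col c) M) (Vec.there v∈)
... | red-v , uncovered = ∈-subset-of⁺ (uncoveredRed? c (restrict M)) (red-v , uncovered ∘ restrict-endpoints M)

module _ {n : ℕ} {c : Fin n → Color} {b : ℕ} (G : Graph n) (u : Fin n) (potential≤b : Potential≤ G c b) where

  private module Step (M : List (Fin (suc n) × Fin (suc n))) (matching : Matching (addLeaf G u) M) where

    private
      M₀ : List (Fin n × Fin n)
      M₀ = restrict M

      U : Color → Subset (suc n)
      U col = uncoveredReds (extend col c) M

      U₀ : Subset n
      U₀ = uncoveredReds c M₀

      ih : length M₀ + ∣ U₀ ∣ ≤ b
      ih = potential≤b M₀ (restrict-matching G u M matching)

      tail≤ : ∀ col → ∣ Vec.tail (U col) ∣ ≤ ∣ U₀ ∣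
      tail≤ col = p⊆q⇒∣p∣≤∣q∣ (tail-uncoveredReds⊆ c col M)

      covered⇒∉ : ∀ col → zero ∈ endpoints M → zero ∉ₛ U col
      covered⇒∉ col 0∈ 0∈ₛ = proj₂ (∈-subset-of⁻ (uncoveredRed? (extend col c) M) 0∈ₛ) 0∈

      black-leaf∉ : zero ∉ₛ U black
      black-leaf∉ 0∈ with ∈-subset-of⁻ (uncoveredRed? (extend black c) M) 0∈
      ... | () , _

    open ≤-Reasoning

    redLeaf : length M + ∣ U red ∣ ≤ suc b
    redLeaf with leaf-cover G u M matching
    ... | leaf-unmatched len = begin
      length M + ∣ U red ∣                  ≤⟨ +-mono-≤ (≤-reflexive len) (∣p∣≤1+∣tail-p∣ (U red)) ⟩
      length M₀ + suc ∣ Vec.tail (U red) ∣  ≤⟨ +-monoʳ-≤ (length M₀) (s≤s (tail≤ red)) ⟩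
      length M₀ + suc ∣ U₀ ∣                ≡⟨ +-suc _ _ ⟩
      suc (length M₀ + ∣ U₀ ∣)              ≤⟨ s≤s ih ⟩
      suc b                                 ∎
    ... | leaf-matched 0∈ _ _ len = begin
      length M + ∣ U red ∣                  ≡⟨ cong₂ _+_ len (∣p∣≡∣tail-p∣ (U red) (covered⇒∉ red 0∈)) ⟩
      suc (length M₀ + ∣ Vec.tail (U red) ∣) ≤⟨ s≤s (+-monoʳ-≤ (length M₀) (tail≤ red)) ⟩
      suc (length M₀ + ∣ U₀ ∣)              ≤⟨ s≤s ih ⟩
      suc b                                 ∎

    -- Matching the new black leaf to u costs u its place among the uncovered red vertices.
    blackLeaf : c u ≡ red → length M + ∣ U black ∣ ≤ b
    blackLeaf red-u with leaf-cover G u M matching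
    ... | leaf-unmatched len = begin
      length M + ∣ U black ∣                 ≡⟨ cong₂ _+_ len (∣p∣≡∣tail-p∣ (U black) black-leaf∉) ⟩
      length M₀ + ∣ Vec.tail (U black) ∣     ≤⟨ +-monoʳ-≤ (length M₀) (tail≤ black) ⟩
      length M₀ + ∣ U₀ ∣                     ≤⟨ ih ⟩
      b                                      ∎
    ... | leaf-matched _ su∈ u∉ len = begin
      length M + ∣ U black ∣                 ≡⟨ cong₂ _+_ len (∣p∣≡∣tail-p∣ (U black) black-leaf∉) ⟩
      suc (length M₀) + ∣ Vec.tail (U black) ∣ ≡⟨ sym (+-suc _ _) ⟩
      length M₀ + suc ∣ Vec.tail (U black) ∣ ≤⟨ +-monoʳ-≤ (length M₀) (p⊂q⇒∣p∣<∣q∣ tail⊂) ⟩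
      length M₀ + ∣ U₀ ∣                     ≤⟨ ih ⟩
      b                                      ∎
      where
      u∉tail : u ∉ₛ Vec.tail (U black)
      u∉tail u∈ = proj₂ (∈-subset-of⁻ (uncoveredRed? (extend black c) M) (Vec.there u∈)) su∈
      tail⊂ : Vec.tail (U black) ⊂ U₀
      tail⊂ = tail-uncoveredReds⊆ c black M , u , ∈-subset-of⁺ (uncoveredRed? c M₀) (red-u , u∉) , u∉tail

  potential≤-addRedLeaf : Potential≤ (addLeaf G u) (extend red c) (suc b)
  potential≤-addRedLeaf = Step.redLeaf

  potential≤-addBlackLeaf : c u ≡ red → Potential≤ (addLeaf G u) (extend black c) b
  potential≤-addBlackLeaf red-u M matching = Step.blackLeaf M matching red-u

-- The cycle graph

CycleAdj : ℕ → ℕ → ℕ → Set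
CycleAdj k x y = suc x ≡ y ⊎ suc y ≡ x ⊎ (x ≡ 0 × suc y ≡ k) ⊎ (y ≡ 0 × suc x ≡ k)

≡ᵇ⇔≡ : ∀ {m n} → T (m ≡ᵇ n) ⇔ (m ≡ n)
≡ᵇ⇔≡ = mk⇔ (≡ᵇ⇒≡ _ _) (≡⇒≡ᵇ _ _)

cycleGraph-adj : ∀ {k} (i j : Fin k) → Adj (cycleGraph k) i j ⇔ CycleAdj k (toℕ i) (toℕ j)
cycleGraph-adj _ _ = ((≡ᵇ⇔≡ ⊎-⇔ ((≡ᵇ⇔≡ ⊎-⇔ ((wrap ⊎-⇔ wrap) ⇔-∘ T-∨)) ⇔-∘ T-∨)) ⇔-∘ T-∨) ⇔-∘ ⇔-sym T-≡
  where
  wrap : ∀ {x m n} → T ((x ≡ᵇ 0) ∧ (m ≡ᵇ n)) ⇔ (x ≡ 0 × m ≡ n)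
  wrap = (≡ᵇ⇔≡ ×-⇔ ≡ᵇ⇔≡) ⇔-∘ T-∧

cycleAdj-sym : ∀ {k x y} → CycleAdj k x y → CycleAdj k y x
cycleAdj-sym (inj₁ p)               = inj₂ (inj₁ p)
cycleAdj-sym (inj₂ (inj₁ p))        = inj₁ p
cycleAdj-sym (inj₂ (inj₂ (inj₁ p))) = inj₂ (inj₂ (inj₂ p))
cycleAdj-sym (inj₂ (inj₂ (inj₂ p))) = inj₂ (inj₂ (inj₁ p))

CycSucc CycPred : ℕ → ℕ → ℕ → Set
CycSucc k x y = (suc x ≡ y × suc x < k) ⊎ (suc x ≡ k × y ≡ 0)
CycPred k x y = suc y ≡ x ⊎ (x ≡ 0 × suc y ≡ k)

cycleAdj⇒cycSucc⊎cycPred : ∀ {k x y} → y < k → CycleAdj k x y → CycSucc k x y ⊎ CycPred k x y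
cycleAdj⇒cycSucc⊎cycPred y<k (inj₁ p)                     = inj₁ (inj₁ (p , subst (_< _) (sym p) y<k))
cycleAdj⇒cycSucc⊎cycPred y<k (inj₂ (inj₁ p))              = inj₂ (inj₁ p)
cycleAdj⇒cycSucc⊎cycPred y<k (inj₂ (inj₂ (inj₁ p)))       = inj₂ (inj₂ p)
cycleAdj⇒cycSucc⊎cycPred y<k (inj₂ (inj₂ (inj₂ (p , q)))) = inj₁ (inj₂ (q , p))

cycSucc-functional : ∀ {k x y y′} → CycSucc k x y → CycSucc k x y′ → y ≡ y′
cycSucc-functional (inj₁ (p , _))  (inj₁ (p′ , _))  = trans (sym p) p′
cycSucc-functional (inj₁ (_ , lt)) (inj₂ (q , _))   = ⊥-elim (<-irrefl q lt)
cycSucc-functional (inj₂ (q , _))  (inj₁ (_ , lt))  = ⊥-elim (<-irrefl q lt)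
cycSucc-functional (inj₂ (_ , p))  (inj₂ (_ , p′))  = trans p (sym p′)

cycPred-functional : ∀ {k x y y′} → CycPred k x y → CycPred k x y′ → y ≡ y′
cycPred-functional (inj₁ p)       (inj₁ p′)       = ℕ.suc-injective (trans p (sym p′))
cycPred-functional (inj₁ refl)    (inj₂ (() , _))
cycPred-functional (inj₂ (() , _)) (inj₁ refl)
cycPred-functional (inj₂ (_ , p)) (inj₂ (_ , p′)) = ℕ.suc-injective (trans p (sym p′))

cycNeighbours-≤2 : ∀ {k x y₁ y₂ y₃} → y₁ ≢ y₂ →
  CycSucc k x y₁ ⊎ CycPred k x y₁ → CycSucc k x y₂ ⊎ CycPred k x y₂ → CycSucc k x y₃ ⊎ CycPred k x y₃ →
  y₃ ≡ y₁ ⊎ y₃ ≡ y₂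
cycNeighbours-≤2 y₁≢y₂ (inj₁ s₁) (inj₁ s₂) _ = ⊥-elim (y₁≢y₂ (cycSucc-functional s₁ s₂))
cycNeighbours-≤2 y₁≢y₂ (inj₂ p₁) (inj₂ p₂) _ = ⊥-elim (y₁≢y₂ (cycPred-functional p₁ p₂))
cycNeighbours-≤2 _ (inj₁ s₁) (inj₂ p₂) (inj₁ s₃) = inj₁ (cycSucc-functional s₃ s₁)
cycNeighbours-≤2 _ (inj₁ s₁) (inj₂ p₂) (inj₂ p₃) = inj₂ (cycPred-functional p₃ p₂)
cycNeighbours-≤2 _ (inj₂ p₁) (inj₁ s₂) (inj₁ s₃) = inj₂ (cycSucc-functional s₃ s₂)
cycNeighbours-≤2 _ (inj₂ p₁) (inj₁ s₂) (inj₂ p₃) = inj₁ (cycPred-functional p₃ p₁)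

module _ {k : ℕ} where

  private
    C : Graph k
    C = cycleGraph k

    classify : ∀ {x y} → Adj C x y → CycSucc k (toℕ x) (toℕ y) ⊎ CycPred k (toℕ x) (toℕ y)
    classify {x} {y} adj = cycleAdj⇒cycSucc⊎cycPred (toℕ<n y) (Equivalence.to (cycleGraph-adj x y) adj)

  cycleGraph-sym : ∀ i j → Adj C i j → Adj C j i
  cycleGraph-sym i j = Equivalence.from (cycleGraph-adj j i) ∘ cycleAdj-sym ∘ Equivalence.to (cycleGraph-adj i j)

  cycleGraph-degree≤2 : ∀ {x y₁ y₂ y₃} → y₁ ≢ y₂ → Adj C x y₁ → Adj C x y₂ → Adj C x y₃ → y₃ ≡ y₁ ⊎ y₃ ≡ y₂
  cycleGraph-degree≤2 y₁≢y₂ a₁ a₂ a₃ =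
    Sum.map toℕ-injective toℕ-injective
      (cycNeighbours-≤2 (y₁≢y₂ ∘ toℕ-injective) (classify a₁) (classify a₂) (classify a₃))

module _ {k′ : ℕ} where

  private
    C : Graph (suc k′)
    C = cycleGraph (suc k′)

  walk-from-zero : ∀ m (b : Fin (suc k′)) → toℕ b ≡ m → Walk C zero b
  walk-from-zero zero    zero    _   = []
  walk-from-zero (suc m) b       b≡m = walk-from-zero m p (toℕ-fromℕ< m<k) ++ʷ (p~b ∷ [])
    where
    m<k : m < suc k′
    m<k = ≤-trans (n≤1+n (suc m)) (subst (_< suc k′) b≡m (toℕ<n b))
    p : Fin (suc k′)
    p = fromℕ< m<k
    p~b : Adj C p b
    p~b = Equivalence.from (cycleGraph-adj p b) (inj₁ (trans (cong suc (toℕ-fromℕ< m<k)) (sym b≡m)))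

  cycleGraph-connected : Connected C
  cycleGraph-connected a b = reverseʷ cycleGraph-sym (walk-from-zero _ a refl) ++ʷ walk-from-zero _ b refl

  module _ {ws : List (Fin (suc k′))} (cyc : IsCycle C ws) where

    private
      edges : ∀ a b → CycEdge ws a b → Adj C a b
      edges = proj₂ (proj₂ cyc)

    -- x has two distinct neighbours on the cycle, and no other neighbour in C at all.
    cycleGraph-edge∈cycle : ∀ {x w} → x ∈ ws → Adj C x w → CycEdge ws x w
    cycleGraph-edge∈cycle {x} {w} x∈ x~w with cycle-neighbours ws (proj₁ cyc) (proj₁ (proj₂ cyc)) x∈
    ... | y , z , y≢z , xy , xz with cycleGraph-degree≤2 {y₃ = w} y≢z (edges x y xy) (edges x z xz) x~w
    ... | inj₁ refl = xy
    ... | inj₂ refl = xz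

    cycleGraph-vertex∈cycle : ∀ v → v ∈ ws
    cycleGraph-vertex∈cycle v = along (cycleGraph-connected _ v) (proj₂ (some-member ws (proj₁ cyc)))
      where
      some-member : ∀ xs → 3 ≤ length xs → Σ (Fin (suc k′)) (_∈ xs)
      some-member (x ∷ _) _ = x , here refl
      along : ∀ {x v} → Walk C x v → x ∈ ws → v ∈ ws
      along []      x∈ = x∈
      along (e ∷ w) x∈ = along w (cycEdge-∈ʳ (cycleGraph-edge∈cycle x∈ e))

    cycleGraph-edges⊆cycle : ∀ a b → Adj C a b → CycEdge ws a b
    cycleGraph-edges⊆cycle a b = cycleGraph-edge∈cycle (cycleGraph-vertex∈cycle a)

module _ {k′ : ℕ} where

  private
    C : Graph (suc k′)
    C = cycleGraph (suc k′)
    L : List (Fin (suc k′))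
    L = allFin (suc k′)

    closed-range : map toℕ (L ++ take 1 L) ≡ range 0 (suc k′) ++ 0 ∷ []
    closed-range = trans (map-++ toℕ L (zero ∷ [])) (cong (_++ 0 ∷ []) (map-toℕ-tabulate {suc k′} id 0 λ _ → refl))

  allFin-consec⇒cycleAdj : ∀ {a b} → Consec (L ++ take 1 L) a b → CycleAdj (suc k′) (toℕ a) (toℕ b)
  allFin-consec⇒cycleAdj {a} {b} c
    with consec-range 0 (suc k′) 0 (subst (λ zs → Consec zs (toℕ a) (toℕ b)) closed-range (consec-map⁺ toℕ c))
  ... | inj₁ p       = inj₁ p
  ... | inj₂ (p , q) = inj₂ (inj₂ (inj₂ (q , p)))

  allFin-cycEdge⇒adj : ∀ {a b} → CycEdge L a b → Adj C a b
  allFin-cycEdge⇒adj {a} {b} (inj₁ c) = Equivalence.from (cycleGraph-adj a b) (allFin-consec⇒cycleAdj c)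
  allFin-cycEdge⇒adj {a} {b} (inj₂ c) = Equivalence.from (cycleGraph-adj a b) (cycleAdj-sym (allFin-consec⇒cycleAdj c))

  allFin-cycle : 3 ≤ suc k′ → IsCycle C L
  allFin-cycle 3≤ = subst (3 ≤_) (sym (length-tabulate id)) 3≤ , Unique.allFin⁺ (suc k′) , λ a b → allFin-cycEdge⇒adj

  cycleGraph-unicyclic : 3 ≤ suc k′ → Unicyclic C
  cycleGraph-unicyclic 3≤ = L , allFin-cycle 3≤ , λ ws cyc a b →
    (λ e → cycleGraph-edges⊆cycle cyc a b (allFin-cycEdge⇒adj e)) ,
    (λ e → cycleGraph-edges⊆cycle (allFin-cycle 3≤) a b (proj₂ (proj₂ cyc) a b e))

NoTwoConsecutive : ∀ {m} → Subset m → Set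
NoTwoConsecutive {m} S = ∀ (i j : Fin m) → suc (toℕ i) ≡ toℕ j → i ∈ₛ S → j ∈ₛ S → ⊥

noTwoConsecutive-tail : ∀ {m x} {S : Subset m} → NoTwoConsecutive (x ∷ S) → NoTwoConsecutive S
noTwoConsecutive-tail ntc i j j≡1+i i∈ j∈ = ntc (suc i) (suc j) (cong suc j≡1+i) (Vec.there i∈) (Vec.there j∈)

-- The empty subset counts as ending in outside.
lastSide : ∀ {m} → Subset m → Side
lastSide []          = outside
lastSide (x ∷ [])    = x
lastSide (x ∷ y ∷ S) = lastSide (y ∷ S)

lastSide-outside∷ : ∀ {m} (S : Subset m) → lastSide (outside ∷ S) ≡ lastSide S
lastSide-outside∷ []      = refl
lastSide-outside∷ (_ ∷ _) = refl

lastSide-inside : ∀ {m} (S : Subset (suc m)) → lastSide S ≡ inside → fromℕ m ∈ₛ S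
lastSide-inside (inside ∷ [])    refl = Vec.here
lastSide-inside (x ∷ y ∷ S)      eq   = Vec.there (lastSide-inside (y ∷ S) eq)

indicator : Side → ℕ
indicator inside  = 1
indicator outside = 0

m+indicator≤1+m : ∀ m x → m + indicator x ≤ suc m
m+indicator≤1+m m inside  = ≤-reflexive (+-comm m 1)
m+indicator≤1+m m outside = ≤-trans (≤-reflexive (+-identityʳ m)) (n≤1+n m)

-- On a path, the last vertex is the only one that may be chosen without forcing its successor out.
noTwoConsecutive-size : ∀ {m} (S : Subset m) → NoTwoConsecutive S → ∣ S ∣ + ∣ S ∣ ≤ m + indicator (lastSide S)
noTwoConsecutive-size []                     _   = z≤n
noTwoConsecutive-size (outside ∷ [])         _   = z≤n
noTwoConsecutive-size (inside ∷ [])          _   = ≤-refl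
noTwoConsecutive-size (outside ∷ y ∷ S)      ntc = ≤-trans (noTwoConsecutive-size (y ∷ S) (noTwoConsecutive-tail ntc)) (n≤1+n _)
noTwoConsecutive-size (inside ∷ inside ∷ S)  ntc = ⊥-elim (ntc zero (suc zero) refl Vec.here (Vec.there Vec.here))
noTwoConsecutive-size {suc (suc m)} (inside ∷ outside ∷ S) ntc = begin
  suc (∣ S ∣ + suc ∣ S ∣)              ≡⟨ cong suc (+-suc ∣ S ∣ ∣ S ∣) ⟩
  suc (suc (∣ S ∣ + ∣ S ∣))            ≤⟨ s≤s (s≤s (noTwoConsecutive-size S (noTwoConsecutive-tail (noTwoConsecutive-tail ntc)))) ⟩
  suc (suc (m + indicator (lastSide S))) ≡⟨ cong (λ x → suc (suc (m + indicator x))) (sym (lastSide-outside∷ S)) ⟩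
  suc (suc (m + indicator (lastSide (outside ∷ S)))) ∎
  where open ≤-Reasoning

module _ {k′ : ℕ} where

  private
    C : Graph (suc k′)
    C = cycleGraph (suc k′)

    first~last : Adj C zero (fromℕ k′)
    first~last = Equivalence.from (cycleGraph-adj zero (fromℕ k′)) (inj₂ (inj₂ (inj₁ (refl , cong suc (toℕ-fromℕ k′)))))

  independent⇒noTwoConsecutive : ∀ {S} → Independent C S → NoTwoConsecutive S
  independent⇒noTwoConsecutive ind i j j≡1+i i∈ j∈
    with trans (sym (ind i j i∈ j∈)) (Equivalence.from (cycleGraph-adj i j) (inj₁ j≡1+i))
  ... | ()

  cycleGraph-independent-size : ∀ S → Independent C S → ∣ S ∣ + ∣ S ∣ ≤ suc k′
  cycleGraph-independent-size (outside ∷ S) ind =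
    ≤-trans (noTwoConsecutive-size S (noTwoConsecutive-tail (independent⇒noTwoConsecutive ind)))
            (m+indicator≤1+m k′ (lastSide S))
  cycleGraph-independent-size (inside ∷ S) ind with lastSide (inside ∷ S) in last
  ... | outside =
    ≤-trans (noTwoConsecutive-size (inside ∷ S) (independent⇒noTwoConsecutive ind))
            (≤-reflexive (trans (cong (λ x → suc k′ + indicator x) last) (+-identityʳ (suc k′))))
  ... | inside with trans (sym (ind zero (fromℕ k′) Vec.here (lastSide-inside (inside ∷ S) last))) first~last
  ... | ()

endpoints-length : ∀ {n} (M : List (Fin n × Fin n)) → length (endpoints M) ≡ length M + length M
endpoints-length []      = refl
endpoints-length (_ ∷ M) = cong suc (trans (cong suc (endpoints-length M)) (sym (+-suc (length M) (length M))))

matching-size : ∀ {n} {G : Graph n} M → Matching G M → length M + length M ≤ n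
matching-size M (_ , uniq) = subst (_≤ _) (endpoints-length M) (unique-length≤ (endpoints M) uniq)

m+m≤1+n+n⇒m≤n : ∀ {m n} → m + m ≤ suc (n + n) → m ≤ n
m+m≤1+n+n⇒m≤n {zero}          _        = z≤n
m+m≤1+n+n⇒m≤n {suc m} {zero}  (s≤s le) = contradiction (subst (_≤ 0) (+-suc m m) le) λ ()
m+m≤1+n+n⇒m≤n {suc m} {suc n} (s≤s le) =
  s≤s (m+m≤1+n+n⇒m≤n (≤-pred (subst₂ _≤_ (+-suc m m) (cong suc (+-suc n n)) le)))

odd⇒≡1+half+half : ∀ k → k % 2 ≡ 1 → k ≡ suc (k / 2 + k / 2)
odd⇒≡1+half+half k odd = begin
  k                     ≡⟨ m≡m%n+[m/n]*n k 2 ⟩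
  k % 2 + k / 2 * 2     ≡⟨ cong₂ _+_ odd (*-comm (k / 2) 2) ⟩
  suc (k / 2 + (k / 2 + 0)) ≡⟨ cong (λ x → suc (k / 2 + x)) (+-identityʳ (k / 2)) ⟩
  suc (k / 2 + k / 2)   ∎
  where open ≡-Reasoning

-- The invariant of the construction

μ≤ : ∀ {n} → Graph n → ℕ → Set
μ≤ G b = ∀ M → Matching G M → length M ≤ b

¬KonigEgervary : ∀ {n} {G : Graph n} {a b} → α≤ G a → μ≤ G b → suc (a + b) ≡ n → ¬ KonigEgervary G
¬KonigEgervary {a = a} {b} α≤a μ≤b size (α , μ , ((S , ind , ∣S∣≡α) , _) , ((M , matching , ∣M∣≡μ) , _) , α+μ≡n) =
  1+n≰n (subst (_≤ a + b) (trans α+μ≡n (sym size))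
    (+-mono-≤ (subst (_≤ a) ∣S∣≡α (α≤a S ind)) (subst (_≤ b) ∣M∣≡μ (μ≤b M matching))))

potential≤⇒μ≤ : ∀ {n} {G : Graph n} {c b} → Potential≤ G c b → μ≤ G b
potential≤⇒μ≤ potential≤b M matching = ≤-trans (m≤m+n (length M) _) (potential≤b M matching)

uncoveredReds-allBlue : ∀ {n} M → ∣ uncoveredReds {n} (λ _ → blue) M ∣ ≡ 0
uncoveredReds-allBlue {n} M =
  n≤0⇒n≡0 (subst (∣ uncoveredReds (λ _ → blue) M ∣ ≤_) (∣⊥∣≡0 n) (p⊆q⇒∣p∣≤∣q∣ ⊆⊥))
  where
  ⊆⊥ : uncoveredReds (λ _ → blue) M ⊆ ⊥ₛ
  ⊆⊥ v∈ with ∈-subset-of⁻ (uncoveredRed? (λ _ → blue) M) v∈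
  ... | () , _

μ≤⇒allBlue-potential≤ : ∀ {n} {G : Graph n} {b} → μ≤ G b → Potential≤ G (λ _ → blue) b
μ≤⇒allBlue-potential≤ {b = b} μ≤b M matching =
  subst (_≤ b) (sym (trans (cong (length M +_) (uncoveredReds-allBlue M)) (+-identityʳ (length M)))) (μ≤b M matching)

record Invariant {n} (G : Graph n) (c : Fin n → Color) : Set where
  field
    connected   : Connected G
    unicyclic   : Unicyclic G
    a b         : ℕ
    α≤a         : α≤ G a
    potential≤b : Potential≤ G c b
    size        : suc (a + b) ≡ n

oddCycle-invariant : ∀ k′ → suc k′ % 2 ≡ 1 → 3 ≤ suc k′ → Invariant (cycleGraph (suc k′)) (λ _ → blue)
oddCycle-invariant k′ odd 3≤ = record
  { connected   = cycleGraph-connected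
  ; unicyclic   = cycleGraph-unicyclic 3≤
  ; a           = t
  ; b           = t
  ; α≤a         = λ S ind → half (cycleGraph-independent-size S ind)
  ; potential≤b = μ≤⇒allBlue-potential≤ λ M matching → half (matching-size M matching)
  ; size        = sym k≡1+t+t
  }
  where
  t : ℕ
  t = suc k′ / 2
  k≡1+t+t : suc k′ ≡ suc (t + t)
  k≡1+t+t = odd⇒≡1+half+half (suc k′) odd
  half : ∀ {m} → m + m ≤ suc k′ → m ≤ t
  half {m} le = m+m≤1+n+n⇒m≤n (subst (m + m ≤_) k≡1+t+t le)

invariant : ∀ {n G c} → Built n G c → Invariant G c
invariant (step1 (suc k′) odd 3≤) = oddCycle-invariant k′ odd 3≤
invariant (step3 {n} {G} {c} built u) = record
  { connected   = addLeaf-connected G₁ zero (addLeaf-connected G u connected)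
  ; unicyclic   = addLeaf-unicyclic G₁ zero (addLeaf-unicyclic G u unicyclic)
  ; a           = suc a
  ; b           = suc b
  ; α≤a         = α≤-addPendantEdge G u α≤a
  ; potential≤b = potential≤-addBlackLeaf {c = extend red c} G₁ zero (potential≤-addRedLeaf {c = c} G u potential≤b) refl
  ; size        = cong (2 +_) (trans (+-suc a b) size)
  }
  where
  open Invariant (invariant built)
  G₁ : Graph (suc n)
  G₁ = addLeaf G u
invariant (step4 {G = G} {c} built u red-u) = record
  { connected   = addLeaf-connected G u connected
  ; unicyclic   = addLeaf-unicyclic G u unicyclic
  ; a           = suc a
  ; b           = b
  ; α≤a         = α≤-addLeaf G u α≤a
  ; potential≤b = potential≤-addBlackLeaf {c = c} G u potential≤b red-u
  ; size        = cong suc size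
  }
  where
  open Invariant (invariant built)

theorem4p6 : (n : ℕ) (G : Graph n) (c : Fin n → Color) → Built n G c →
    Connected G × Unicyclic G × ¬ KonigEgervary G
theorem4p6 n G c built = connected , unicyclic , ¬KonigEgervary α≤a (potential≤⇒μ≤ {c = c} potential≤b) size
  where open Invariant (invariant built)
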